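{- Let $p$ be a prime. For all integers $n,k$, \[\binom{n}{k}\equiv\binom{n}{k}_p \pmod p.\]
   Context: For integers $a,j$, $\binom{a}{j}$ denotes the coefficient of $x^j$ in $(1+x)^a$: for $a\ge0$ in the polynomial (so $0$ if $j<0$ or $j>a$); for $a<0,j\ge0$ in the power series expansion about $x=0$; for $a<0,j<0$ in the expansion as a power series in $1/x$. For a base $b\ge2$ (here $b=p$): every integer $r\ge0$ has base-$b$ digits $r_l\in\{0,\dots,b-1\}$ with $r=\sum_{l\ge0}r_lb^l$; by convention, for $r>0$ the digits of $-r$ are $-r_l$. For $r\in\mathbb Z$ with digits $r_l$, put $f_{r,b}(x)=\prod_{l\ge0}(1+x^{b^l})^{r_l}$. The $b$-ary binomial coefficient $\binom{r}{k}_b$ ($r,k\in\mathbb Z$) is defined as: if $r\ge0$, the coefficient of $x^k$ in the polynomial $f_{r,b}(x)$ (zero for $k<0$); if $r<0$ and $k\ge0$, the coefficient of $x^k$ in the power series expansion of $f_{r,b}(x)$ about $x=0$; if $r<0$ and $k<0$, the coefficient of $x^k$ in the expansion of $f_{r,b}(x)$ as a power series in $1/x$. -}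

module Defs where

open import Data.Nat as ℕ using (ℕ; zero; suc; _^_; NonZero; _≤ᵇ_; _≡ᵇ_)
open import Data.Nat.DivMod using (_/_; _%_)
open import Data.Integer as ℤ using (ℤ; +_; -[1+_])
open import Data.Bool using (if_then_else_)

-- Formal power series in one variable x with integer coefficients:
-- a series is its coefficient function (n ↦ coefficient of x^n).
PS : Set
PS = ℕ → ℤ

Σ≤ : ℕ → (ℕ → ℤ) → ℤ
Σ≤ zero    f = f zero
Σ≤ (suc n) f = Σ≤ n f ℤ.+ f (suc n)

one : PS
one n = if n ≡ᵇ 0 then + 1 else + 0

mono : ℕ → PS
mono m n = if n ≡ᵇ m then + 1 else + 0

_⊕_ : PS → PS → PS
(f ⊕ g) n = f n ℤ.+ g n

_⊖_ : PS → PS → PS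
(f ⊖ g) n = f n ℤ.- g n

neg : PS → PS
neg f n = ℤ.- f n

_⊛_ : PS → PS → PS
(f ⊛ g) n = Σ≤ n (λ i → f i ℤ.* g (n ℕ.∸ i))

pow : PS → ℕ → PS
pow f zero    = one
pow f (suc e) = f ⊛ pow f e

-- multiplicative inverse of a series f with constant term 1:
-- writing f = 1 + u (u = f - 1, no constant term), 1/f = Σ_j (-u)^j;
-- the coefficient of x^n only involves the terms j ≤ n.
inv : PS → PS
inv f n = Σ≤ n (λ j → pow (neg (f ⊖ one)) j n)

zpow : PS → ℤ → PS
zpow f (+ e)     = pow f e
zpow f -[1+ e ]  = inv (pow f (suc e))

Π< : ℕ → (ℕ → PS) → PS
Π< zero    f = one
Π< (suc n) f = Π< n f ⊛ f n

-- Coefficient of x^k in the expansion of a rational function F(x) of the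
-- form F(x) = x^r · G(1/x) (when expanded in 1/x) with G(y) = g a power
-- series in y, and F(x) = g(x) as power series in x for the other cases.
-- Concretely, for r,k ∈ ℤ:
--   r ≥ 0 : F = g is a polynomial; coefficient of x^k is g k for k ≥ 0, 0 for k < 0;
--   r < 0, k ≥ 0 : coefficient of x^k in the power series g about 0;
--   r < 0, k < 0 : expansion in 1/x: F(x) = x^r g(1/x), so the coefficient
--                  of x^k is the coefficient of y^(r-k) in g (0 if r-k < 0).
lcoeff : ℤ → PS → ℤ → ℤ
lcoeff (+ n)     g (+ k)     = g k
lcoeff (+ n)     g -[1+ k ]  = + 0
lcoeff -[1+ n ]  g (+ k)     = g k
lcoeff -[1+ n ]  g -[1+ k ]  = if n ≤ᵇ k then g (k ℕ.∸ n) else + 0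
-- (r - k = -(n+1) + (k+1) = k - n.)

1+x^ : ℕ → PS
1+x^ m = one ⊕ mono m

-- Ordinary (generalized) binomial coefficient: coefficient of x^j in (1+x)^a.
-- For a < 0, j < 0: (1+x)^a = x^a (1+1/x)^a, expanded in y = 1/x.
binom : ℤ → ℤ → ℤ
binom a j = lcoeff a (zpow (1+x^ 1) a) j

digit : (b : ℕ) → .{{NonZero b}} → ℕ → ℕ → ℕ
digit b r zero    = r % b
digit b r (suc l) = digit b (r / b) l

-- f_{r,b} for r ≥ 0 : Π_l (1 + x^{b^l})^{r_l}.  Digits r_l vanish for l ≥ r+1
-- (as b^l > r), so the product over l < r+1 is the full product.
fpos : (b : ℕ) → .{{NonZero b}} → ℕ → PS
fpos b r = Π< (suc r) (λ l → pow (1+x^ (b ^ l)) (digit b r l))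

-- f_{r,b} for r = -m < 0 : digits of -m are -m_l, so
-- f = Π_l (1 + x^{b^l})^{-m_l}   (as a power series about 0).
fneg : (b : ℕ) → .{{NonZero b}} → ℕ → PS
fneg b m = Π< (suc m) (λ l → inv (pow (1+x^ (b ^ l)) (digit b m l)))

f[_,_] : ℤ → (b : ℕ) → .{{NonZero b}} → PS
f[ + n    , b ] = fpos b n
f[ -[1+ n ] , b ] = fneg b (suc n)

-- b-ary binomial coefficient (r choose k)_b.
-- For r < 0, k < 0: f_{r,b}(x) = x^r · Π_l (1 + (1/x)^{b^l})^{-r_l}, and
-- Π_l (1 + y^{b^l})^{-r_l} is the same power series f_{r,b}(y); hence lcoeff.
binomB : (b : ℕ) → .{{NonZero b}} → ℤ → ℤ → ℤ
binomB b r k = lcoeff r f[ r , b ] k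

module Submission where

-- Both sides are coefficients, extracted by the same `lcoeff n`, of power
-- series: (1 + x)^n and f_{n,p} = Π_l (1 + x^(p^l))^(n_l) for n ≥ 0, and
-- their inverses for n < 0.  It therefore suffices to show that these series
-- are congruent modulo p coefficientwise.

open import Defs
open import Data.Nat as ℕ
  using (ℕ; zero; suc; _≤_; _<_; z≤n; s≤s; _∸_; _^_; _!; NonZero; NonTrivial)
import Data.Nat.Properties as ℕP
open import Data.Nat.DivMod using (_/_; _%_; m≡m%n+[m/n]*n; m/n<m; 0/n≡0)
import Data.Nat.Divisibility as ℕD
open import Data.Nat.Combinatorics using (_C_; nCn≡1; nCk≡n!/k![n-k]!; k![n∸k]!∣n!)
open import Data.Nat.Primality
  using (Prime; euclidsLemma; ¬prime[1]; prime⇒nonTrivial; prime⇒nonZero)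
import Data.Nat.Tactic.RingSolver as ℕSolver
open import Data.Integer as ℤ using (ℤ; +_; -[1+_]; _+_; _*_; -_; _-_)
import Data.Integer.Properties as ℤP
open import Data.Integer.Tactic.RingSolver using (solve-∀)
open import Data.Integer.Divisibility using (_∣_)
open import Data.Integer.Divisibility.Signed as Div using (divides)
open import Data.Fin as Fin using (toℕ; fromℕ; inject₁)
import Data.Fin.Properties as FinP
open import Data.Vec.Functional using (tail; init; replicate)
open import Data.Bool using (true; false; if_then_else_)
open import Data.Sum using (inj₁; inj₂)
open import Data.Empty using (⊥-elim)
open import Level using (0ℓ)
open import Algebra.Bundles using (CommutativeSemiring)
open import Algebra.Structures.Biased using (isCommutativeSemiringˡ; isCommutativeMonoidˡ)
import Algebra.Properties.CommutativeSemigroup as CommSemigroupProperties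
import Algebra.Properties.CommutativeSemiring.Binomial as Binomial
import Algebra.Properties.Semiring.Mult as SemiringMult
import Algebra.Properties.Semiring.Exp as SemiringExp
import Algebra.Properties.Monoid.Sum as MonoidSum
open import Relation.Binary.Structures using (IsEquivalence)
import Relation.Binary.Reasoning.Setoid as SetoidReasoning
open import Relation.Binary.PropositionalEquality
open import Relation.Nullary using (¬_; yes; no)
open import Relation.Nullary.Decidable using (dec-true; dec-false)

Σ-cong : ∀ n {f g : ℕ → ℤ} → (∀ i → i ≤ n → f i ≡ g i) → Σ≤ n f ≡ Σ≤ n g
Σ-cong zero    f≡g = f≡g 0 z≤n
Σ-cong (suc n) f≡g =
  cong₂ _+_ (Σ-cong n (λ i i≤n → f≡g i (ℕP.m≤n⇒m≤1+n i≤n))) (f≡g (suc n) ℕP.≤-refl)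

Σ-zero : ∀ n {f : ℕ → ℤ} → (∀ i → i ≤ n → f i ≡ + 0) → Σ≤ n f ≡ + 0
Σ-zero zero    f≡0 = f≡0 0 z≤n
Σ-zero (suc n) f≡0 =
  cong₂ _+_ (Σ-zero n (λ i i≤n → f≡0 i (ℕP.m≤n⇒m≤1+n i≤n))) (f≡0 (suc n) ℕP.≤-refl)

Σ-+ : ∀ n (f g : ℕ → ℤ) → Σ≤ n (λ i → f i + g i) ≡ Σ≤ n f + Σ≤ n g
Σ-+ zero    f g = refl
Σ-+ (suc n) f g = trans (cong (_+ (f (suc n) + g (suc n))) (Σ-+ n f g))
                        (swap (Σ≤ n f) (Σ≤ n g) (f (suc n)) (g (suc n)))
  where
  swap : ∀ a b c d → (a + b) + (c + d) ≡ (a + c) + (b + d)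
  swap = solve-∀

Σ-*ˡ : ∀ n c (f : ℕ → ℤ) → Σ≤ n (λ i → c * f i) ≡ c * Σ≤ n f
Σ-*ˡ zero    c f = refl
Σ-*ˡ (suc n) c f = trans (cong (_+ (c * f (suc n))) (Σ-*ˡ n c f))
                         (sym (ℤP.*-distribˡ-+ c (Σ≤ n f) (f (suc n))))

Σ-*ʳ : ∀ n c (f : ℕ → ℤ) → Σ≤ n (λ i → f i * c) ≡ Σ≤ n f * c
Σ-*ʳ n c f = begin
  Σ≤ n (λ i → f i * c) ≡⟨ Σ-cong n (λ i _ → ℤP.*-comm (f i) c) ⟩
  Σ≤ n (λ i → c * f i) ≡⟨ Σ-*ˡ n c f ⟩
  c * Σ≤ n f           ≡⟨ ℤP.*-comm c (Σ≤ n f) ⟩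
  Σ≤ n f * c           ∎
  where open ≡-Reasoning

Σ-head : ∀ n (f : ℕ → ℤ) → Σ≤ (suc n) f ≡ f 0 + Σ≤ n (λ i → f (suc i))
Σ-head zero    f = refl
Σ-head (suc n) f = trans (cong (_+ f (suc (suc n))) (Σ-head n f)) (ℤP.+-assoc (f 0) _ _)

Σ-reverse : ∀ n (f : ℕ → ℤ) → Σ≤ n f ≡ Σ≤ n (λ i → f (n ∸ i))
Σ-reverse zero    f = refl
Σ-reverse (suc n) f = begin
  Σ≤ (suc n) f                        ≡⟨ Σ-head n f ⟩
  f 0 + Σ≤ n (λ i → f (suc i))        ≡⟨ cong (λ s → f 0 + s) (Σ-reverse n (λ i → f (suc i))) ⟩
  f 0 + Σ≤ n (λ i → f (suc (n ∸ i)))  ≡⟨ ℤP.+-comm (f 0) _ ⟩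
  Σ≤ n (λ i → f (suc (n ∸ i))) + f 0  ≡⟨ cong₂ _+_ (Σ-cong n (λ i i≤n → cong f (sym (ℕP.+-∸-assoc 1 i≤n))))
                                                 (cong f (sym (ℕP.n∸n≡0 n))) ⟩
  Σ≤ (suc n) (λ i → f (suc n ∸ i))    ∎
  where open ≡-Reasoning

Σ-swap : ∀ n m (H : ℕ → ℕ → ℤ) →
         Σ≤ n (λ i → Σ≤ m (H i)) ≡ Σ≤ m (λ j → Σ≤ n (λ i → H i j))
Σ-swap zero    m H = refl
Σ-swap (suc n) m H = trans (cong (_+ Σ≤ m (H (suc n))) (Σ-swap n m H))
                           (sym (Σ-+ m (λ j → Σ≤ n (λ i → H i j)) (H (suc n))))

Σ-triangle : ∀ n (F : ℕ → ℕ → ℤ) →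
             Σ≤ n (λ i → Σ≤ i (F i)) ≡ Σ≤ n (λ j → Σ≤ (n ∸ j) (λ t → F (j ℕ.+ t) j))
Σ-triangle zero    F = refl
Σ-triangle (suc n) F = begin
  Σ≤ n (λ i → Σ≤ i (F i)) + Σ≤ (suc n) (F (suc n))
    ≡⟨ cong (_+ Σ≤ (suc n) (F (suc n))) (Σ-triangle n F) ⟩
  R + (Σ≤ n (F (suc n)) + F (suc n) (suc n))
    ≡⟨ sym (ℤP.+-assoc R _ _) ⟩
  (R + Σ≤ n (F (suc n))) + F (suc n) (suc n)
    ≡⟨ cong₂ _+_ (sym (Σ-+ n _ _)) diagonal ⟩
  Σ≤ n (λ j → Σ≤ (n ∸ j) (column j) + F (suc n) j) + Σ≤ (suc n ∸ suc n) (column (suc n))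
    ≡⟨ cong (_+ Σ≤ (suc n ∸ suc n) (column (suc n))) (Σ-cong n extend) ⟩
  Σ≤ (suc n) (λ j → Σ≤ (suc n ∸ j) (column j)) ∎
  where
  open ≡-Reasoning
  column : ℕ → ℕ → ℤ
  column j t = F (j ℕ.+ t) j
  R = Σ≤ n (λ j → Σ≤ (n ∸ j) (column j))
  diagonal : F (suc n) (suc n) ≡ Σ≤ (suc n ∸ suc n) (column (suc n))
  diagonal rewrite ℕP.n∸n≡0 n | ℕP.+-identityʳ n = refl
  -- the new row i = n+1 extends every column j ≤ n by one entry
  extend : ∀ j → j ≤ n → Σ≤ (n ∸ j) (column j) + F (suc n) j ≡ Σ≤ (suc n ∸ j) (column j)
  extend j j≤n = begin
    Σ≤ (n ∸ j) (column j) + F (suc n) j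
      ≡⟨ cong (λ k → Σ≤ (n ∸ j) (column j) + F k j)
              (sym (trans (ℕP.+-suc j (n ∸ j)) (cong suc (ℕP.m+[n∸m]≡n j≤n)))) ⟩
    Σ≤ (suc (n ∸ j)) (column j)
      ≡⟨ cong (λ k → Σ≤ k (column j)) (sym (ℕP.+-∸-assoc 1 j≤n)) ⟩
    Σ≤ (suc n ∸ j) (column j) ∎
    where open ≡-Reasoning

Σ-single : ∀ n a (f : ℕ → ℤ) → (∀ i → i ≢ a → f i ≡ + 0) → a ≤ n → Σ≤ n f ≡ f a
Σ-single n a f vanish a≤n with ℕP.m≤n⇒m<n∨m≡n a≤n
Σ-single (suc n) a f vanish _ | inj₁ a<1+n =
  trans (cong₂ _+_ (Σ-single n a f vanish (ℕP.≤-pred a<1+n)) (vanish (suc n) (ℕP.>⇒≢ a<1+n)))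
        (ℤP.+-identityʳ (f a))
Σ-single zero    a f vanish _ | inj₂ refl = refl
Σ-single (suc n) a f vanish _ | inj₂ refl =
  trans (cong (_+ f (suc n)) (Σ-zero n (λ i i≤n → vanish i (ℕP.<⇒≢ (s≤s i≤n)))))
        (ℤP.+-identityˡ (f (suc n)))

Σ-truncate : ∀ N k (f : ℕ → ℤ) → k ≤ N → (∀ j → k < j → f j ≡ + 0) → Σ≤ N f ≡ Σ≤ k f
Σ-truncate N k f k≤N vanish with ℕP.m≤n⇒m<n∨m≡n k≤N
Σ-truncate (suc N) k f _ vanish | inj₁ k<1+N =
  trans (cong₂ _+_ (Σ-truncate N k f (ℕP.≤-pred k<1+N) vanish) (vanish (suc N) k<1+N))
        (ℤP.+-identityʳ (Σ≤ k f))
... | inj₂ refl = refl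

Σ-telescope : ∀ N (g : ℕ → ℤ) → Σ≤ N g - Σ≤ N (λ j → g (suc j)) ≡ g 0 - g (suc N)
Σ-telescope zero    g = refl
Σ-telescope (suc N) g = begin
  (Σ≤ N g + g (suc N)) - (Σ≤ N (λ j → g (suc j)) + g (suc (suc N)))
    ≡⟨ regroup (Σ≤ N g) (Σ≤ N (λ j → g (suc j))) (g (suc N)) (g (suc (suc N))) ⟩
  (Σ≤ N g - Σ≤ N (λ j → g (suc j))) + (g (suc N) - g (suc (suc N)))
    ≡⟨ cong (_+ (g (suc N) - g (suc (suc N)))) (Σ-telescope N g) ⟩
  (g 0 - g (suc N)) + (g (suc N) - g (suc (suc N)))
    ≡⟨ cancel (g 0) (g (suc N)) (g (suc (suc N))) ⟩
  g 0 - g (suc (suc N)) ∎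
  where
  open ≡-Reasoning
  regroup : ∀ a b c d → (a + c) - (b + d) ≡ (a - b) + (c - d)
  regroup = solve-∀
  cancel : ∀ x y z → (x - y) + (y - z) ≡ x - z
  cancel = solve-∀

infix 4 _≐_
_≐_ : PS → PS → Set
f ≐ g = ∀ n → f n ≡ g n

zeroPS : PS
zeroPS _ = + 0

⊛-cong : ∀ {f f′ g g′} → f ≐ f′ → g ≐ g′ → f ⊛ g ≐ f′ ⊛ g′
⊛-cong f≐f′ g≐g′ n = Σ-cong n (λ i _ → cong₂ _*_ (f≐f′ i) (g≐g′ (n ∸ i)))

⊛-comm : ∀ f g → f ⊛ g ≐ g ⊛ f
⊛-comm f g n = begin
  Σ≤ n (λ i → f i * g (n ∸ i))              ≡⟨ Σ-reverse n _ ⟩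
  Σ≤ n (λ i → f (n ∸ i) * g (n ∸ (n ∸ i)))  ≡⟨ Σ-cong n swap ⟩
  Σ≤ n (λ i → g i * f (n ∸ i))              ∎
  where
  open ≡-Reasoning
  swap : ∀ i → i ≤ n → f (n ∸ i) * g (n ∸ (n ∸ i)) ≡ g i * f (n ∸ i)
  swap i i≤n = trans (cong (λ k → f (n ∸ i) * g k) (ℕP.m∸[m∸n]≡n i≤n)) (ℤP.*-comm (f (n ∸ i)) (g i))

⊛-identityˡ : ∀ f → one ⊛ f ≐ f
⊛-identityˡ f zero    = ℤP.*-identityˡ (f 0)
⊛-identityˡ f (suc n) = begin
  Σ≤ (suc n) (λ i → one i * f (suc n ∸ i))
    ≡⟨ Σ-head n _ ⟩
  + 1 * f (suc n) + Σ≤ n (λ i → + 0 * f (n ∸ i))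
    ≡⟨ cong₂ _+_ (ℤP.*-identityˡ (f (suc n))) (Σ-zero n (λ i _ → ℤP.*-zeroˡ (f (n ∸ i)))) ⟩
  f (suc n) + + 0
    ≡⟨ ℤP.+-identityʳ (f (suc n)) ⟩
  f (suc n) ∎
  where open ≡-Reasoning

⊛-zeroˡ : ∀ f → zeroPS ⊛ f ≐ zeroPS
⊛-zeroˡ f n = Σ-zero n (λ i _ → ℤP.*-zeroˡ (f (n ∸ i)))

⊛-distribʳ-⊕ : ∀ f g h → (g ⊕ h) ⊛ f ≐ (g ⊛ f) ⊕ (h ⊛ f)
⊛-distribʳ-⊕ f g h n =
  trans (Σ-cong n (λ i _ → ℤP.*-distribʳ-+ (f (n ∸ i)) (g i) (h i))) (Σ-+ n _ _)

⊛-assoc : ∀ f g h → (f ⊛ g) ⊛ h ≐ f ⊛ (g ⊛ h)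
⊛-assoc f g h n = begin
  Σ≤ n (λ i → Σ≤ i (λ j → f j * g (i ∸ j)) * h (n ∸ i))
    ≡⟨ Σ-cong n (λ i _ → sym (Σ-*ʳ i (h (n ∸ i)) _)) ⟩
  Σ≤ n (λ i → Σ≤ i (λ j → f j * g (i ∸ j) * h (n ∸ i)))
    ≡⟨ Σ-triangle n _ ⟩
  Σ≤ n (λ j → Σ≤ (n ∸ j) (λ t → f j * g (j ℕ.+ t ∸ j) * h (n ∸ (j ℕ.+ t))))
    ≡⟨ Σ-cong n (λ j _ → Σ-cong (n ∸ j) (λ t _ → reindex j t)) ⟩
  Σ≤ n (λ j → Σ≤ (n ∸ j) (λ t → f j * (g t * h (n ∸ j ∸ t))))
    ≡⟨ Σ-cong n (λ j _ → Σ-*ˡ (n ∸ j) (f j) _) ⟩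
  Σ≤ n (λ j → f j * Σ≤ (n ∸ j) (λ t → g t * h (n ∸ j ∸ t))) ∎
  where
  open ≡-Reasoning
  reindex : ∀ j t → f j * g (j ℕ.+ t ∸ j) * h (n ∸ (j ℕ.+ t)) ≡ f j * (g t * h (n ∸ j ∸ t))
  reindex j t = trans (cong₂ (λ a b → f j * g a * h b) (ℕP.m+n∸m≡n j t) (sym (ℕP.∸-+-assoc n j t)))
                      (ℤP.*-assoc (f j) _ _)

pow-+ : ∀ f a b → pow f (a ℕ.+ b) ≐ pow f a ⊛ pow f b
pow-+ f zero    b n = sym (⊛-identityˡ (pow f b) n)
pow-+ f (suc a) b n = trans (⊛-cong {f} {f} (λ _ → refl) (pow-+ f a b) n)
                            (sym (⊛-assoc f (pow f a) (pow f b) n))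

pow-* : ∀ f a b → pow f (a ℕ.* b) ≐ pow (pow f b) a
pow-* f zero    b n = refl
pow-* f (suc a) b n = trans (pow-+ f b (a ℕ.* b) n)
                            (⊛-cong {pow f b} {pow f b} (λ _ → refl) (pow-* f a b) n)

pow-one : ∀ k → pow one k ≐ one
pow-one zero    n = refl
pow-one (suc k) n = trans (⊛-identityˡ (pow one k) n) (pow-one k n)

mono-diag : ∀ a → mono a a ≡ + 1
mono-diag a = cong (λ b → if b then + 1 else + 0) (dec-true (a ℕ.≟ a) refl)

mono-off : ∀ {a n} → n ≢ a → mono a n ≡ + 0
mono-off {a} {n} n≢a = cong (λ b → if b then + 1 else + 0) (dec-false (n ℕ.≟ a) n≢a)

mono-shift : ∀ a b {n} → a ≤ n → mono b (n ∸ a) ≡ mono (a ℕ.+ b) n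
mono-shift a b {n} a≤n with (n ∸ a) ℕ.≟ b
... | yes n∸a≡b =
  trans (cong (mono b) n∸a≡b)
        (trans (mono-diag b) (sym (trans (cong (mono (a ℕ.+ b)) n≡a+b) (mono-diag (a ℕ.+ b)))))
  where
  n≡a+b : n ≡ a ℕ.+ b
  n≡a+b = trans (sym (ℕP.m+[n∸m]≡n a≤n)) (cong (a ℕ.+_) n∸a≡b)
... | no n∸a≢b =
  trans (mono-off n∸a≢b) (sym (mono-off (λ n≡a+b → n∸a≢b (trans (cong (_∸ a) n≡a+b) (ℕP.m+n∸m≡n a b)))))

term-off : ∀ a b n i → i ≢ a → mono a i * mono b (n ∸ i) ≡ + 0
term-off a b n i i≢a =
  trans (cong (_* mono b (n ∸ i)) (mono-off {a} i≢a)) (ℤP.*-zeroˡ (mono b (n ∸ i)))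

mono-+ : ∀ a b → mono a ⊛ mono b ≐ mono (a ℕ.+ b)
mono-+ a b n with a ℕ.≤? n
... | yes a≤n = begin
  Σ≤ n (λ i → mono a i * mono b (n ∸ i)) ≡⟨ Σ-single n a _ (term-off a b n) a≤n ⟩
  mono a a * mono b (n ∸ a)              ≡⟨ cong₂ _*_ (mono-diag a) (mono-shift a b a≤n) ⟩
  + 1 * mono (a ℕ.+ b) n                 ≡⟨ ℤP.*-identityˡ _ ⟩
  mono (a ℕ.+ b) n                       ∎
  where open ≡-Reasoning
... | no a≰n =
  trans (Σ-zero n (λ i i≤n → term-off a b n i (λ i≡a → a≰n (subst (_≤ n) i≡a i≤n))))
        (sym (mono-off {a ℕ.+ b} (λ n≡a+b → a≰n (subst (a ≤_) (sym n≡a+b) (ℕP.m≤m+n a b)))))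

mono-pow : ∀ a k → pow (mono a) k ≐ mono (k ℕ.* a)
mono-pow a zero    n = refl
mono-pow a (suc k) n =
  trans (⊛-cong {mono a} {mono a} (λ _ → refl) (mono-pow a k) n) (mono-+ a (k ℕ.* a) n)

const-pow : ∀ f e → f 0 ≡ + 1 → pow f e 0 ≡ + 1
const-pow f zero    f₀ = refl
const-pow f (suc e) f₀ = cong₂ _*_ f₀ (const-pow f e f₀)

const-Π : ∀ L (B : ℕ → PS) → (∀ l → B l 0 ≡ + 1) → Π< L B 0 ≡ + 1
const-Π zero    B B₀ = refl
const-Π (suc L) B B₀ = cong₂ _*_ (const-Π L B B₀) (B₀ L)

const-1+x^ : ∀ a → 0 < a → (1+x^ a) 0 ≡ + 1
const-1+x^ a 0<a = cong (λ t → + 1 + t) (mono-off {a} (ℕP.<⇒≢ 0<a))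

pow-low : ∀ u → u 0 ≡ + 0 → ∀ j n → n < j → pow u j n ≡ + 0
pow-low u u₀ (suc j) n n<1+j = Σ-zero n (term n n<1+j)
  where
  term : ∀ n → n < suc j → ∀ i → i ≤ n → u i * pow u j (n ∸ i) ≡ + 0
  term n        _     zero    _          = trans (cong (_* pow u j n) u₀) (ℤP.*-zeroˡ (pow u j n))
  term (suc n′) n<1+j (suc i) (s≤s i≤n′) =
    trans (cong (u (suc i) *_) (pow-low u u₀ j (n′ ∸ i) n′∸i<j)) (ℤP.*-zeroʳ (u (suc i)))
    where
    n′∸i<j : n′ ∸ i < j
    n′∸i<j = ℕP.≤-<-trans (ℕP.m∸n≤m n′ i) (ℕP.≤-pred n<1+j)

module Inverse (A : PS) (A₀ : A 0 ≡ + 1) where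

  u : PS
  u = neg (A ⊖ one)

  u₀ : u 0 ≡ + 0
  u₀ = cong (λ a → - (a - + 1)) A₀

  geometric : ℕ → PS
  geometric N n = Σ≤ N (λ j → pow u j n)

  inv-geometric : ∀ N n → n ≤ N → inv A n ≡ geometric N n
  inv-geometric N n n≤N =
    sym (Σ-truncate N n (λ j → pow u j n) n≤N (λ j n<j → pow-low u u₀ j n n<j))

  u⊛geometric : ∀ N n → (u ⊛ geometric N) n ≡ Σ≤ N (λ j → pow u (suc j) n)
  u⊛geometric N n =
    trans (Σ-cong n (λ i _ → sym (Σ-*ˡ N (u i) (λ j → pow u j (n ∸ i)))))
          (Σ-swap n N (λ i j → u i * pow u j (n ∸ i)))

  A⊛geometric : ∀ N n → (A ⊛ geometric N) n ≡ one n - pow u (suc N) n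
  A⊛geometric N n = begin
    (A ⊛ S) n                            ≡⟨ split ((A ⊛ S) n) ((u ⊛ S) n) ⟩
    ((A ⊛ S) n + (u ⊛ S) n) - (u ⊛ S) n  ≡⟨ cong (_- (u ⊛ S) n) (sym (⊛-distribʳ-⊕ S A u n)) ⟩
    ((A ⊕ u) ⊛ S) n - (u ⊛ S) n          ≡⟨ cong₂ _-_ (trans (⊛-cong {g = S} {g′ = S} A⊕u≐one (λ _ → refl) n)
                                                            (⊛-identityˡ S n))
                                                     (u⊛geometric N n) ⟩
    S n - Σ≤ N (λ j → pow u (suc j) n)   ≡⟨ Σ-telescope N (λ j → pow u j n) ⟩
    one n - pow u (suc N) n              ∎
    where
    open ≡-Reasoning
    S = geometric N
    split : ∀ x y → x ≡ (x + y) - y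
    split = solve-∀
    A⊕u≐one : A ⊕ u ≐ one
    A⊕u≐one k = cancel (A k) (one k)
      where
      cancel : ∀ a o → a + - (a - o) ≡ o
      cancel = solve-∀

  inv-inverse : A ⊛ inv A ≐ one
  inv-inverse n = begin
    (A ⊛ inv A) n            ≡⟨ Σ-cong n (λ i _ → cong (A i *_) (inv-geometric n (n ∸ i) (ℕP.m∸n≤m n i))) ⟩
    (A ⊛ geometric n) n      ≡⟨ A⊛geometric n n ⟩
    one n - pow u (suc n) n  ≡⟨ cong (λ t → one n - t) (pow-low u u₀ (suc n) n ℕP.≤-refl) ⟩
    one n - + 0              ≡⟨ ℤP.+-identityʳ (one n) ⟩
    one n                    ∎
    where open ≡-Reasoning

-- Congruence of integers modulo m: m divides a - b.  It is a record, so that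
-- the three integers can be inferred from a proof of a congruence.

infix 4 _≡_mod_
record _≡_mod_ (a b m : ℤ) : Set where
  constructor mod-intro
  field divides-difference : m Div.∣ (a - b)
open _≡_mod_ public

mod-by : ∀ {m x a b} → x ≡ a - b → m Div.∣ x → a ≡ b mod m
mod-by {m} x≡a-b m∣x = mod-intro (subst (m Div.∣_) x≡a-b m∣x)

mod-reflexive : ∀ {m a b} → a ≡ b → a ≡ b mod m
mod-reflexive {m} {a} refl = mod-by (sym (ℤP.+-inverseʳ a)) (divides (+ 0) (sym (ℤP.*-zeroˡ m)))

mod-sym : ∀ {m a b} → a ≡ b mod m → b ≡ a mod m
mod-sym {a = a} {b} (mod-intro m∣a-b) = mod-by (flip a b) (Div.∣m⇒∣-m m∣a-b)
  where
  flip : ∀ a b → - (a - b) ≡ b - a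
  flip = solve-∀

mod-trans : ∀ {m a b c} → a ≡ b mod m → b ≡ c mod m → a ≡ c mod m
mod-trans {a = a} {b} {c} (mod-intro m∣a-b) (mod-intro m∣b-c) =
  mod-by (chain a b c) (Div.∣m∣n⇒∣m+n m∣a-b m∣b-c)
  where
  chain : ∀ a b c → (a - b) + (b - c) ≡ a - c
  chain = solve-∀

mod-+ : ∀ {m a b c d} → a ≡ b mod m → c ≡ d mod m → a + c ≡ b + d mod m
mod-+ {a = a} {b} {c} {d} (mod-intro m∣a-b) (mod-intro m∣c-d) =
  mod-by (regroup a b c d) (Div.∣m∣n⇒∣m+n m∣a-b m∣c-d)
  where
  regroup : ∀ a b c d → (a - b) + (c - d) ≡ (a + c) - (b + d)
  regroup = solve-∀

mod-* : ∀ {m a b c d} → a ≡ b mod m → c ≡ d mod m → a * c ≡ b * d mod m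
mod-* {a = a} {b} {c} {d} (mod-intro m∣a-b) (mod-intro m∣c-d) =
  mod-by (regroup a b c d) (Div.∣m∣n⇒∣m+n (Div.∣n⇒∣m*n a m∣c-d) (Div.∣m⇒∣m*n d m∣a-b))
  where
  regroup : ∀ a b c d → a * (c - d) + (a - b) * d ≡ a * c - b * d
  regroup = solve-∀

Σ-mod : ∀ {m} n {f g : ℕ → ℤ} → (∀ i → i ≤ n → f i ≡ g i mod m) → Σ≤ n f ≡ Σ≤ n g mod m
Σ-mod zero    f≡g = f≡g 0 z≤n
Σ-mod (suc n) f≡g =
  mod-+ (Σ-mod n (λ i i≤n → f≡g i (ℕP.m≤n⇒m≤1+n i≤n))) (f≡g (suc n) ℕP.≤-refl)

module SeriesMod (m : ℤ) where

  infix 4 _≈_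
  record _≈_ (f g : PS) : Set where
    constructor coeffwise
    field coeff : ∀ n → f n ≡ g n mod m
  open _≈_ public

  ≐⇒≈ : ∀ {f g} → f ≐ g → f ≈ g
  ≐⇒≈ f≐g = coeffwise (λ n → mod-reflexive (f≐g n))

  ≈-isEquivalence : IsEquivalence _≈_
  ≈-isEquivalence = record
    { refl  = coeffwise (λ n → mod-reflexive refl)
    ; sym   = λ f≈g → coeffwise (λ n → mod-sym (coeff f≈g n))
    ; trans = λ f≈g g≈h → coeffwise (λ n → mod-trans (coeff f≈g n) (coeff g≈h n))
    }

  ⊕-≈ : ∀ {f f′ g g′} → f ≈ f′ → g ≈ g′ → f ⊕ g ≈ f′ ⊕ g′
  ⊕-≈ f≈f′ g≈g′ = coeffwise (λ n → mod-+ (coeff f≈f′ n) (coeff g≈g′ n))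

  ⊛-≈ : ∀ {f f′ g g′} → f ≈ f′ → g ≈ g′ → f ⊛ g ≈ f′ ⊛ g′
  ⊛-≈ f≈f′ g≈g′ = coeffwise (λ n → Σ-mod n (λ i _ → mod-* (coeff f≈f′ i) (coeff g≈g′ (n ∸ i))))

  semiring : CommutativeSemiring 0ℓ 0ℓ
  semiring = record
    { Carrier = PS
    ; _≈_     = _≈_
    ; _+_     = _⊕_
    ; _*_     = _⊛_
    ; 0#      = zeroPS
    ; 1#      = one
    ; isCommutativeSemiring = isCommutativeSemiringˡ record
      { +-isCommutativeMonoid = isCommutativeMonoidˡ record
        { isSemigroup = record
          { isMagma = record { isEquivalence = ≈-isEquivalence ; ∙-cong = ⊕-≈ }
          ; assoc   = λ f g h → ≐⇒≈ (λ n → ℤP.+-assoc (f n) (g n) (h n))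
          }
        ; identityˡ = λ f → ≐⇒≈ (λ n → ℤP.+-identityˡ (f n))
        ; comm      = λ f g → ≐⇒≈ (λ n → ℤP.+-comm (f n) (g n))
        }
      ; *-isCommutativeMonoid = isCommutativeMonoidˡ record
        { isSemigroup = record
          { isMagma = record { isEquivalence = ≈-isEquivalence ; ∙-cong = ⊛-≈ }
          ; assoc   = λ f g h → ≐⇒≈ (⊛-assoc f g h)
          }
        ; identityˡ = λ f → ≐⇒≈ (⊛-identityˡ f)
        ; comm      = λ f g → ≐⇒≈ (⊛-comm f g)
        }
      ; distribʳ = λ f g h → ≐⇒≈ (⊛-distribʳ-⊕ f g h)
      ; zeroˡ    = λ f → ≐⇒≈ (⊛-zeroˡ f)
      }
    }

  open CommutativeSemiring semiring
    using (*-assoc; *-comm; *-identityˡ; *-identityʳ; *-congˡ; *-congʳ; *-commutativeSemigroup)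
    renaming (refl to ≈-refl; trans to ≈-trans)
  module ≈-Reasoning = SetoidReasoning (CommutativeSemiring.setoid semiring)
  open CommSemigroupProperties *-commutativeSemigroup using (interchange)

  Π<-≈ : ∀ L {f g : ℕ → PS} → (∀ l → f l ≈ g l) → Π< L f ≈ Π< L g
  Π<-≈ zero    f≈g = ≈-refl
  Π<-≈ (suc L) f≈g = ⊛-≈ (Π<-≈ L f≈g) (f≈g L)

  pow-≈ : ∀ {f g} k → f ≈ g → pow f k ≈ pow g k
  pow-≈ zero    f≈g = ≈-refl
  pow-≈ (suc k) f≈g = ⊛-≈ f≈g (pow-≈ k f≈g)

  inverse-unique : ∀ {A X Y} → A ⊛ X ≈ one → A ⊛ Y ≈ one → X ≈ Y
  inverse-unique {A} {X} {Y} AX≈1 AY≈1 = begin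
    X            ≈⟨ *-identityʳ X ⟨
    X ⊛ one      ≈⟨ *-congˡ {X} AY≈1 ⟨
    X ⊛ (A ⊛ Y)  ≈⟨ *-assoc X A Y ⟨
    (X ⊛ A) ⊛ Y  ≈⟨ *-congʳ {Y} (≈-trans (*-comm X A) AX≈1) ⟩
    one ⊛ Y      ≈⟨ *-identityˡ Y ⟩
    Y            ∎
    where open ≈-Reasoning

  inv-≈ : ∀ {A B} → A 0 ≡ + 1 → B 0 ≡ + 1 → A ≈ B → inv A ≈ inv B
  inv-≈ {A} {B} A₀ B₀ A≈B = inverse-unique {A} {inv A} {inv B} (≐⇒≈ (Inverse.inv-inverse A A₀))
    (≈-trans (*-congʳ {inv B} A≈B) (≐⇒≈ (Inverse.inv-inverse B B₀)))

  inv-⊛ : ∀ {A B} → A 0 ≡ + 1 → B 0 ≡ + 1 → inv (A ⊛ B) ≈ inv A ⊛ inv B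
  inv-⊛ {A} {B} A₀ B₀ = inverse-unique {A ⊛ B} {inv (A ⊛ B)} {inv A ⊛ inv B}
    (≐⇒≈ (Inverse.inv-inverse (A ⊛ B) (cong₂ _*_ A₀ B₀)))
    (begin
      (A ⊛ B) ⊛ (inv A ⊛ inv B)  ≈⟨ interchange A B (inv A) (inv B) ⟩
      (A ⊛ inv A) ⊛ (B ⊛ inv B)  ≈⟨ ⊛-≈ (≐⇒≈ (Inverse.inv-inverse A A₀)) (≐⇒≈ (Inverse.inv-inverse B B₀)) ⟩
      one ⊛ one                  ≈⟨ *-identityˡ one ⟩
      one                        ∎)
    where open ≈-Reasoning

  inv-Π : ∀ L (B : ℕ → PS) → (∀ l → B l 0 ≡ + 1) → inv (Π< L B) ≈ Π< L (λ l → inv (B l))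
  inv-Π zero    B B₀ =
    inverse-unique {one} {inv one} {one} (≐⇒≈ (Inverse.inv-inverse one refl)) (*-identityˡ one)
  inv-Π (suc L) B B₀ =
    ≈-trans (inv-⊛ {Π< L B} {B L} (const-Π L B B₀) (B₀ L)) (⊛-≈ (inv-Π L B B₀) (≈-refl {inv (B L)}))

  lcoeff-≈ : ∀ r {f g} → f ≈ g → ∀ k → lcoeff r f k ≡ lcoeff r g k mod m
  lcoeff-≈ (+ n)    f≈g (+ k)    = coeff f≈g k
  lcoeff-≈ (+ n)    f≈g -[1+ k ] = mod-reflexive refl
  lcoeff-≈ -[1+ n ] f≈g (+ k)    = coeff f≈g k
  lcoeff-≈ -[1+ n ] f≈g -[1+ k ] with n ℕ.≤ᵇ k
  ... | true  = coeff f≈g (k ∸ n)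
  ... | false = mod-reflexive refl

factorial-split : ∀ {n k} → k ≤ n → n ! ≡ (n C k) ℕ.* (k ! ℕ.* (n ∸ k) !)
factorial-split {n} {k} k≤n =
  trans (ℕD.m∣n⇒n≡quotient*m d∣n!)
        (cong (ℕ._* d) (sym (trans (nCk≡n!/k![n-k]! k≤n) (ℕD.n/m≡quotient d∣n!))))
  where
  d = k ! ℕ.* (n ∸ k) !
  d∣n! : d ℕD.∣ n !
  d∣n! = k![n∸k]!∣n! k≤n
  instance
    d≢0 : NonZero d
    d≢0 = ℕP.m*n≢0 (k !) ((n ∸ k) !) {{ℕP._!≢0 k}} {{ℕP._!≢0 (n ∸ k)}}

prime∤factorial : ∀ {p} → Prime p → ∀ m → m < p → ¬ p ℕD.∣ m !
prime∤factorial pp zero    _   p∣1 = ¬prime[1] (subst Prime (ℕD.∣1⇒≡1 p∣1) pp)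
prime∤factorial pp (suc m) m<p p∣m! with euclidsLemma (suc m) (m !) pp p∣m!
... | inj₁ p∣1+m = ℕP.<⇒≱ m<p (ℕD.∣⇒≤ p∣1+m)
... | inj₂ p∣m!′ = prime∤factorial pp m (ℕP.<-trans (ℕP.n<1+n m) m<p) p∣m!′

-- p divides p! = (p C k) · k! (p-k)! but neither k! nor (p-k)!.
prime∣binomial : ∀ {p k} → Prime p → 0 < k → k < p → p ℕD.∣ p C k
prime∣binomial {p@(suc p′)} {k} pp 0<k k<p
  with euclidsLemma (p C k) (k ! ℕ.* (p ∸ k) !) pp
         (subst (p ℕD.∣_) (factorial-split (ℕP.<⇒≤ k<p)) (ℕD.m∣m*n (p′ !)))
... | inj₁ p∣C = p∣C
... | inj₂ p∣k![p-k]! with euclidsLemma (k !) ((p ∸ k) !) pp p∣k![p-k]!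
...   | inj₁ p∣k!     = ⊥-elim (prime∤factorial pp k k<p p∣k!)
...   | inj₂ p∣[p-k]! =
  ⊥-elim (prime∤factorial pp (p ∸ k) (ℕP.∸-monoʳ-< 0<k (ℕP.<⇒≤ k<p)) p∣[p-k]!)

module _ (m : ℤ) where
  open SeriesMod m
  open CommutativeSemiring semiring
    using (+-monoid; +-comm; +-cong; +-congˡ; +-congʳ; +-identityˡ; *-cong; *-identityˡ; *-identityʳ)
    renaming (refl to ≈-refl; sym to ≈-sym; trans to ≈-trans)
  open SemiringMult (CommutativeSemiring.semiring semiring) using (_×_; ×-cong; ×-homo-1)
  open MonoidSum +-monoid using (sum; sum-init-last; sum-cong-≋; sum-replicate-zero)
  open SemiringExp (CommutativeSemiring.semiring semiring) using (^-congʳ) renaming (_^_ to _⊛^_)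
  open Binomial semiring using (theorem; binomialTerm)

  pow≈⊛^ : ∀ x k → pow x k ≈ x ⊛^ k
  pow≈⊛^ x zero    = ≈-refl
  pow≈⊛^ x (suc k) = ⊛-≈ (≈-refl {x}) (pow≈⊛^ x k)

  ×-coeff : ∀ k z n → (k × z) n ≡ + k * z n
  ×-coeff zero    z n = sym (ℤP.*-zeroˡ (z n))
  ×-coeff (suc k) z n = trans (cong (λ t → z n + t) (×-coeff k z n)) (sym (ℤP.suc-* (+ k) (z n)))

  ×-multiple : ∀ k z → m Div.∣ + k → k × z ≈ zeroPS
  ×-multiple k z m∣k = coeffwise (λ n →
    mod-by (sym (trans (cong (_- + 0) (×-coeff k z n)) (ℤP.+-identityʳ (+ k * z n))))
           (Div.∣m⇒∣m*n (z n) m∣k))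

  -- In the binomial expansion Σ_{k ≤ n} (n C k) x^k y^(n-k) only the two
  -- extreme terms survive.
  freshman : ∀ n .{{_ : NonZero n}} → (∀ k → 0 < k → k < n → m Div.∣ + (n C k)) →
             ∀ x y → pow (x ⊕ y) n ≈ pow x n ⊕ pow y n
  freshman (suc n) m∣C x y = begin
    pow (x ⊕ y) (suc n)             ≈⟨ pow≈⊛^ (x ⊕ y) (suc n) ⟩
    (x ⊕ y) ⊛^ suc n                ≈⟨ theorem (suc n) x y ⟩
    T₀ ⊕ sum (tail T)               ≈⟨ +-congˡ {T₀} (sum-init-last (tail T)) ⟩
    T₀ ⊕ (sum (init (tail T)) ⊕ Tₙ) ≈⟨ +-congˡ {T₀} (+-congʳ {Tₙ} middle-vanishes) ⟩
    T₀ ⊕ (zeroPS ⊕ Tₙ)              ≈⟨ +-congˡ {T₀} (+-identityˡ Tₙ) ⟩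
    T₀ ⊕ Tₙ                         ≈⟨ +-comm T₀ Tₙ ⟩
    Tₙ ⊕ T₀                         ≈⟨ +-cong last-term first-term ⟩
    pow x (suc n) ⊕ pow y (suc n)   ∎
    where
    open ≈-Reasoning
    T = binomialTerm x y (suc n)
    T₀ = T Fin.zero
    Tₙ = T (fromℕ (suc n))
    middle : ∀ i → T (Fin.suc (inject₁ i)) ≈ replicate n zeroPS i
    middle i = ×-multiple _ _ (m∣C (suc (toℕ (inject₁ i))) (s≤s z≤n)
                 (s≤s (subst (_< n) (sym (FinP.toℕ-inject₁ i)) (FinP.toℕ<n i))))
    middle-vanishes : sum (init (tail T)) ≈ zeroPS
    middle-vanishes = ≈-trans (sum-cong-≋ middle) (sum-replicate-zero n)
    first-term : T₀ ≈ pow y (suc n)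
    first-term = ≈-trans (×-homo-1 _) (≈-trans (*-identityˡ _) (≈-sym (pow≈⊛^ y (suc n))))
    last-term : Tₙ ≈ pow x (suc n)
    last-term = begin
      Tₙ                        ≈⟨ ×-cong top-coefficient (*-cong (^-congʳ x top) (^-congʳ y no-y)) ⟩
      1 × ((x ⊛^ suc n) ⊛ one)  ≈⟨ ×-homo-1 _ ⟩
      (x ⊛^ suc n) ⊛ one        ≈⟨ *-identityʳ _ ⟩
      x ⊛^ suc n                ≈⟨ pow≈⊛^ x (suc n) ⟨
      pow x (suc n)             ∎
      where
      top : toℕ (fromℕ (suc n)) ≡ suc n
      top = FinP.toℕ-fromℕ (suc n)
      top-coefficient : suc n C toℕ (fromℕ (suc n)) ≡ 1
      top-coefficient = trans (cong (suc n C_) top) (nCn≡1 (suc n))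
      no-y : suc n ∸ toℕ (fromℕ (suc n)) ≡ 0
      no-y = trans (cong (suc n ∸_) top) (ℕP.n∸n≡0 (suc n))

module Digits (b : ℕ) .{{_ : NonTrivial b}} where

  instance
    b≢0 : NonZero b
    b≢0 = ℕ.nonTrivial⇒nonZero b

  quo : ℕ → ℕ → ℕ
  quo n zero    = n
  quo n (suc L) = quo n L / b

  quo-/ : ∀ n l → quo (n / b) l ≡ quo n l / b
  quo-/ n zero    = refl
  quo-/ n (suc l) = cong (_/ b) (quo-/ n l)

  digit-quo : ∀ n l → digit b n l ≡ quo n l % b
  digit-quo n zero    = refl
  digit-quo n (suc l) = trans (digit-quo (n / b) l) (cong (_% b) (quo-/ n l))

  quo-split : ∀ n L → quo n L ≡ digit b n L ℕ.+ quo n (suc L) ℕ.* b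
  quo-split n L =
    trans (m≡m%n+[m/n]*n (quo n L) b) (cong (ℕ._+ quo n (suc L) ℕ.* b) (sym (digit-quo n L)))

  -- dividing a positive number by b ≥ 2 decreases it, so quo n L ≤ n - L
  quo-bound : ∀ n L → quo n L ≤ n ∸ L
  quo-bound n zero    = ℕP.≤-refl
  quo-bound n (suc L) = begin
    quo n L / b    ≤⟨ halving (quo n L) ⟩
    quo n L ∸ 1    ≤⟨ ℕP.∸-monoˡ-≤ 1 (quo-bound n L) ⟩
    n ∸ L ∸ 1      ≡⟨ ℕP.∸-+-assoc n L 1 ⟩
    n ∸ (L ℕ.+ 1)  ≡⟨ cong (n ∸_) (ℕP.+-comm L 1) ⟩
    n ∸ suc L      ∎
    where
    open ℕP.≤-Reasoning
    halving : ∀ a → a / b ≤ a ∸ 1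
    halving zero    = ℕP.≤-reflexive (0/n≡0 b)
    halving (suc a) = ℕP.≤-pred (m/n<m (suc a) b (ℕ.nonTrivial⇒n>1 b))

  quo-vanish : ∀ n → quo n (suc n) ≡ 0
  quo-vanish n =
    ℕP.n≤0⇒n≡0 (ℕP.≤-trans (quo-bound n (suc n)) (ℕP.≤-reflexive (ℕP.m≤n⇒m∸n≡0 (ℕP.n≤1+n n))))

module ModPrime {p : ℕ} (pp : Prime p) where

  instance
    p-nonTrivial : NonTrivial p
    p-nonTrivial = prime⇒nonTrivial pp

  open Digits p
  open SeriesMod (+ p)
  open CommutativeSemiring semiring using (*-assoc; *-identityʳ; *-congˡ) renaming (trans to ≈-trans)

  frobenius : ∀ a → pow (1+x^ a) p ≈ 1+x^ (p ℕ.* a)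
  frobenius a = ≈-trans (freshman (+ p) p p∣C one (mono a))
                        (⊕-≈ (≐⇒≈ (pow-one p)) (≐⇒≈ (mono-pow a p)))
    where
    p∣C : ∀ k → 0 < k → k < p → + p Div.∣ + (p C k)
    p∣C k 0<k k<p = Div.∣ᵤ⇒∣ (prime∣binomial pp 0<k k<p)

  frobenius-iterated : ∀ l → pow (1+x^ 1) (p ^ l) ≈ 1+x^ (p ^ l)
  frobenius-iterated zero    = *-identityʳ (1+x^ 1)
  frobenius-iterated (suc l) = begin
    pow (1+x^ 1) (p ℕ.* p ^ l)    ≈⟨ ≐⇒≈ (pow-* (1+x^ 1) p (p ^ l)) ⟩
    pow (pow (1+x^ 1) (p ^ l)) p  ≈⟨ pow-≈ p (frobenius-iterated l) ⟩
    pow (1+x^ (p ^ l)) p          ≈⟨ frobenius (p ^ l) ⟩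
    1+x^ (p ℕ.* p ^ l)            ∎
    where open ≈-Reasoning

  digit-factor : ℕ → ℕ → PS
  digit-factor n l = pow (1+x^ 1) (digit p n l ℕ.* p ^ l)

  expansion : ∀ n L → pow (1+x^ 1) n ≈ Π< L (digit-factor n) ⊛ pow (1+x^ 1) (quo n L ℕ.* p ^ L)
  expansion n zero = ≐⇒≈ (λ i → trans (cong (λ e → pow (1+x^ 1) e i) (sym (ℕP.*-identityʳ n)))
                                       (sym (⊛-identityˡ (pow (1+x^ 1) (n ℕ.* 1)) i)))
  expansion n (suc L) = begin
    pow (1+x^ 1) n                  ≈⟨ expansion n L ⟩
    Π< L (digit-factor n) ⊛ rest L  ≈⟨ *-congˡ {Π< L (digit-factor n)} (≐⇒≈ peel) ⟩
    Π< L (digit-factor n) ⊛ (digit-factor n L ⊛ rest (suc L))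
                                    ≈⟨ *-assoc (Π< L (digit-factor n)) (digit-factor n L) (rest (suc L)) ⟨
    Π< (suc L) (digit-factor n) ⊛ rest (suc L) ∎
    where
    open ≈-Reasoning
    rest : ℕ → PS
    rest L = pow (1+x^ 1) (quo n L ℕ.* p ^ L)
    regroup : ∀ d q p P → (d ℕ.+ q ℕ.* p) ℕ.* P ≡ d ℕ.* P ℕ.+ q ℕ.* (p ℕ.* P)
    regroup = ℕSolver.solve-∀
    split : quo n L ℕ.* p ^ L ≡ digit p n L ℕ.* p ^ L ℕ.+ quo n (suc L) ℕ.* p ^ suc L
    split = trans (cong (ℕ._* p ^ L) (quo-split n L)) (regroup (digit p n L) (quo n (suc L)) p (p ^ L))
    peel : rest L ≐ digit-factor n L ⊛ rest (suc L)
    peel i = trans (cong (λ e → pow (1+x^ 1) e i) split)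
                   (pow-+ (1+x^ 1) (digit p n L ℕ.* p ^ L) (quo n (suc L) ℕ.* p ^ suc L) i)

  positive-case : ∀ n → pow (1+x^ 1) n ≈ fpos p n
  positive-case n = begin
    pow (1+x^ 1) n
      ≈⟨ expansion n (suc n) ⟩
    Π< (suc n) (digit-factor n) ⊛ pow (1+x^ 1) (quo n (suc n) ℕ.* p ^ suc n)
      ≡⟨ cong (λ q → Π< (suc n) (digit-factor n) ⊛ pow (1+x^ 1) (q ℕ.* p ^ suc n)) (quo-vanish n) ⟩
    Π< (suc n) (digit-factor n) ⊛ one
      ≈⟨ *-identityʳ (Π< (suc n) (digit-factor n)) ⟩
    Π< (suc n) (digit-factor n)
      ≈⟨ Π<-≈ (suc n) (λ l → ≈-trans (≐⇒≈ (pow-* (1+x^ 1) (digit p n l) (p ^ l)))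
                                     (pow-≈ (digit p n l) (frobenius-iterated l))) ⟩
    fpos p n ∎
    where open ≈-Reasoning

  negative-case : ∀ n → inv (pow (1+x^ 1) n) ≈ fneg p n
  negative-case n =
    ≈-trans (inv-≈ (const-pow (1+x^ 1) n refl) (const-Π (suc n) factor factor₀) (positive-case n))
            (inv-Π (suc n) factor factor₀)
    where
    factor : ℕ → PS
    factor l = pow (1+x^ (p ^ l)) (digit p n l)
    factor₀ : ∀ l → factor l 0 ≡ + 1
    factor₀ l = const-pow (1+x^ (p ^ l)) (digit p n l) (const-1+x^ (p ^ l) (ℕP.m^n>0 p l))

  binomial-congruence : ∀ n k → binom n k ≡ binomB p n k mod (+ p)
  binomial-congruence (+ n)    k = lcoeff-≈ (+ n) (positive-case n) k
  binomial-congruence -[1+ n ] k = lcoeff-≈ -[1+ n ] (negative-case (suc n)) k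

proposition3p5 : (p : ℕ) → (pp : Prime p) → (n k : ℤ) →
    (+ p) ∣ (binom n k - binomB p {{prime⇒nonZero pp}} n k)
proposition3p5 p pp n k = Div.∣⇒∣ᵤ (divides-difference (ModPrime.binomial-congruence pp n k))
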